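{- Let $1\le r\le d$ and $N\ge1$ be integers, and let $0\le j_1<j_2<\dots<j_N\le r-1$ and $0\le b_1<b_2<\dots<b_N\le d-r$ be integers. For a permutation $\sigma\in S_N$ let $\Sigma(\sigma)=\sum_{k=1}^N b_k\,j_{\sigma(k)}$. Then for every permutation $\sigma\ne\mathrm{id}$, $$\Sigma(\sigma)<\Sigma(\mathrm{id})\le N(d-r)(r-1)-\binom{N}{2}\frac{d}{3},$$ and moreover $\max_{\sigma}\Sigma(\sigma)-\min_{\sigma}\Sigma(\sigma)\le\frac{N(d-r)(r-1)}{2}$. -}

module Defs where

open import Data.Nat using (ℕ; _*_)
open import Data.Fin using (Fin)
open import Data.List using (tabulate)
open import Data.Nat.ListAction using (sum)
open import Data.Fin.Permutation using (Permutation′; _⟨$⟩ʳ_)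

Σperm : ∀ {N} → (b j : Fin N → ℕ) → Permutation′ N → ℕ
Σperm {N} b j σ = sum (tabulate {n = N} (λ k → b k * j (σ ⟨$⟩ʳ k)))

module Submission where

-- Rearrangement bounds for Σ(σ) = ∑ₖ bₖ·j_{σ(k)} with strictly increasing
-- b ≤ B = d − r and j ≤ R = r − 1.
--
-- (i)  Strict rearrangement inequality.  Induction on n: a permutation fixing
--      position 0 reduces to its restriction to the other positions; otherwise
--      swapping position 0 with the position sent to 0 gains strictly, by the
--      two-pair exchange inequality A·v + C·u < A·u + C·v (A < C, u < v).
-- (ii) Upper bound 3Σ(id) + C(N,2)·d ≤ 3N(d−r)(r−1).  Peel off the smallest pair:
--      it satisfies b₀ ≤ B − n and j₀ ≤ R − n when n pairs lie above it, which
--      pays for n(B+R+1), and C(n+1,2) = n + C(n,2); note B + R + 1 = d.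
-- (iii) Spread bound 2Σ(σ) ≤ 2Σ(τ) + N·B·R.  A pointwise inequality between the
--      k-th terms, summed; permutation invariance of ∑ makes the j-sums cancel.

open import Defs
open import Data.Nat using (ℕ; _+_; _*_; _∸_; _≤_; _<_; zero; suc; z≤n; s≤s)
open import Data.Nat.Properties
open import Data.Nat.Combinatorics using (_C_; nCk+nC[k+1]≡[n+1]C[k+1]; nC1≡n)
open import Data.Fin using (Fin; punchIn) renaming (_<_ to _<ᶠ_; zero to fz; suc to fs)
import Data.Fin.Properties as Finₚ
open import Data.Fin.Permutation
  using (Permutation′; id; _≈_; _⟨$⟩ʳ_; _⟨$⟩ˡ_; _∘ₚ_; transpose; remove; punchIn-permute; inverseʳ; inverseˡ)
import Data.Fin.Permutation.Components as Components
open import Data.Vec.Functional using (tail; removeAt)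
open import Data.Product using (_×_; _,_)
open import Data.Sum using (_⊎_; inj₁; inj₂)
open import Relation.Nullary using (¬_; yes; no; contradiction)
open import Relation.Binary.PropositionalEquality
open import Function using (_∘_)
open import Data.List using (tabulate)
import Data.Nat.ListAction as List
open import Data.Nat.Tactic.RingSolver using (solve-∀)
open import Algebra.Properties.Semiring.Sum +-*-semiring
  using (sum; sum-cong-≗; sum-remove; ∑-distrib-+; ∑-permute; *-distribˡ-sum)
open import Algebra.Properties.CommutativeSemigroup +-commutativeSemigroup
  using (xy∙z≈zy∙x; xy∙z≈xz∙y; xy∙z≈x∙zy)

pairing : ∀ {n} → (b j : Fin n → ℕ) → Permutation′ n → ℕ
pairing b j σ = sum λ k → b k * j (σ ⟨$⟩ʳ k)

StrictlyIncreasing : ∀ {n} → (Fin n → ℕ) → Set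
StrictlyIncreasing f = ∀ {k l} → k <ᶠ l → f k < f l

increasing-tail : ∀ {n} {f : Fin (suc n) → ℕ} →
  StrictlyIncreasing f → StrictlyIncreasing (tail f)
increasing-tail f↑ k<l = f↑ (s≤s k<l)

sum-tabulate : ∀ {n} (f : Fin n → ℕ) → List.sum (tabulate f) ≡ sum f
sum-tabulate {zero}  f = refl
sum-tabulate {suc n} f = cong (f fz +_) (sum-tabulate (tail f))

Σperm≡pairing : ∀ {n} (b j : Fin n → ℕ) (σ : Permutation′ n) → Σperm b j σ ≡ pairing b j σ
Σperm≡pairing b j σ = sum-tabulate (λ k → b k * j (σ ⟨$⟩ʳ k))

sum-mono : ∀ {n} {f g : Fin n → ℕ} → (∀ k → f k ≤ g k) → sum f ≤ sum g
sum-mono {zero}  f≤g = z≤n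
sum-mono {suc n} f≤g = +-mono-≤ (f≤g fz) (sum-mono (λ k → f≤g (fs k)))

sum-const : ∀ n c → sum {n} (λ _ → c) ≡ n * c
sum-const zero    c = refl
sum-const (suc n) c = cong (c +_) (sum-const n c)

sum-update : ∀ {n} (f g : Fin n → ℕ) (i : Fin n) → (∀ k → k ≢ i → f k ≡ g k) →
  sum f + g i ≡ sum g + f i
sum-update {suc n} f g i agree = begin
  sum f + g i                     ≡⟨ cong (_+ g i) (sum-remove {i = i} f) ⟩
  f i + sum (removeAt f i) + g i  ≡⟨ cong (λ s → f i + s + g i) (sum-cong-≗ agree-off-i) ⟩
  f i + sum (removeAt g i) + g i  ≡⟨ xy∙z≈zy∙x (f i) (sum (removeAt g i)) (g i) ⟩
  g i + sum (removeAt g i) + f i  ≡⟨ cong (_+ f i) (sum-remove {i = i} g) ⟨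
  sum g + f i                     ∎
  where
  open ≡-Reasoning
  agree-off-i : ∀ k → removeAt f i k ≡ removeAt g i k
  agree-off-i k = agree (punchIn i k) (Finₚ.punchInᵢ≢i i k)

sum-scaled-permuted : ∀ {n} B (j : Fin n → ℕ) (σ : Permutation′ n) →
  sum (λ k → B * j (σ ⟨$⟩ʳ k)) ≡ B * sum j
sum-scaled-permuted B j σ = begin
  sum (λ k → B * j (σ ⟨$⟩ʳ k)) ≡⟨ *-distribˡ-sum B (λ k → j (σ ⟨$⟩ʳ k)) ⟨
  B * sum (λ k → j (σ ⟨$⟩ʳ k)) ≡⟨ cong (B *_) (∑-permute j σ) ⟨
  B * sum j                    ∎
  where open ≡-Reasoning

-- With C = A+1+x and
-- v = u+1+y the gain is exactly (1+x)(1+y).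
exchange : ∀ {A C u v} → A < C → u < v → A * v + C * u < A * u + C * v
exchange {A} {C} {u} {v} A<C u<v with m≤n⇒∃[o]m+o≡n A<C | m≤n⇒∃[o]m+o≡n u<v
... | x , refl | y , refl = subst (A * (suc u + y) + (suc A + x) * u <_) (gain A x u y) (m<m+n _ (s≤s z≤n))
  where
  gain : ∀ A x u y →
    A * (suc u + y) + (suc A + x) * u + (1 + x) * (1 + y) ≡ A * u + (suc A + x) * (suc u + y)
  gain = solve-∀

transpose-left : ∀ {n} (i j : Fin n) → Components.transpose i j i ≡ j
transpose-left i j with i Finₚ.≟ i
... | yes _  = refl
... | no i≢i = contradiction refl i≢i

transpose-right : ∀ {n} (i j : Fin n) → Components.transpose i j j ≡ i
transpose-right i j with j Finₚ.≟ i
... | yes j≡i = j≡i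
... | no _ with j Finₚ.≟ j
...   | yes _  = refl
...   | no j≢j = contradiction refl j≢j

transpose-other : ∀ {n} (i j k : Fin n) → k ≢ i → k ≢ j → Components.transpose i j k ≡ k
transpose-other i j k k≢i k≢j with k Finₚ.≟ i
... | yes k≡i = contradiction k≡i k≢i
... | no _ with k Finₚ.≟ j
...   | yes k≡j = contradiction k≡j k≢j
...   | no _    = refl

DominatedById : ∀ {n} (b j : Fin n → ℕ) → Permutation′ n → Set
DominatedById b j σ = σ ≈ id ⊎ pairing b j σ < pairing b j id

dominated⇒≤ : ∀ {n} (b j : Fin n → ℕ) (σ : Permutation′ n) →
  DominatedById b j σ → pairing b j σ ≤ pairing b j id
dominated⇒≤ b j σ (inj₁ σ≈id) = ≤-reflexive (sum-cong-≗ λ k → cong (λ i → b k * j i) (σ≈id k))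
dominated⇒≤ b j σ (inj₂ σ<id) = <⇒≤ σ<id

fixing-zero-shift : ∀ {n} (σ : Permutation′ (suc n)) → σ ⟨$⟩ʳ fz ≡ fz →
  ∀ k → σ ⟨$⟩ʳ fs k ≡ fs (remove fz σ ⟨$⟩ʳ k)
fixing-zero-shift σ σ0≡0 k = trans (punchIn-permute σ fz k) (cong (λ z → punchIn z (remove fz σ ⟨$⟩ʳ k)) σ0≡0)

dominated-fixing-zero : ∀ {n} (b j : Fin (suc n) → ℕ) (σ : Permutation′ (suc n)) → σ ⟨$⟩ʳ fz ≡ fz →
  DominatedById (tail b) (tail j) (remove fz σ) → DominatedById b j σ
dominated-fixing-zero b j σ σ0≡0 (inj₁ ρ≈id) =
  inj₁ λ { fz → σ0≡0 ; (fs k) → trans (fixing-zero-shift σ σ0≡0 k) (cong fs (ρ≈id k)) }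
dominated-fixing-zero b j σ σ0≡0 (inj₂ ρ<id) = inj₂ (begin-strict
  pairing b j σ                                   ≡⟨ cong₂ _+_ (cong (λ i → b fz * j i) σ0≡0) (sum-cong-≗ tails) ⟩
  b fz * j fz + pairing (tail b) (tail j) ρ       <⟨ +-monoʳ-< (b fz * j fz) ρ<id ⟩
  b fz * j fz + pairing (tail b) (tail j) id      ∎)
  where
  open ≤-Reasoning
  ρ = remove fz σ
  tails : ∀ k → b (fs k) * j (σ ⟨$⟩ʳ fs k) ≡ b (fs k) * j (fs (ρ ⟨$⟩ʳ k))
  tails k = cong (λ i → b (fs k) * j i) (fixing-zero-shift σ σ0≡0 k)

swap-to-zero : ∀ {n} (σ : Permutation′ (suc n)) (q : Fin n) → σ ⟨$⟩ʳ fs q ≡ fz →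
  (transpose fz (fs q) ∘ₚ σ) ⟨$⟩ʳ fz ≡ fz
swap-to-zero σ q σq≡0 = trans (cong (σ ⟨$⟩ʳ_) (transpose-left fz (fs q))) σq≡0

-- Only positions 0
-- and q+1 change, where weights b₀ < b_{q+1} trade the values u = j₀ < v = j_{σ0}
-- (σ0 ≠ 0 by injectivity); the exchange lemma on these two pairs decides it.
swap-gain : ∀ {n} (b j : Fin (suc n) → ℕ) → StrictlyIncreasing b → StrictlyIncreasing j →
  (σ : Permutation′ (suc n)) (q : Fin n) → σ ⟨$⟩ʳ fs q ≡ fz →
  pairing b j σ < pairing b j (transpose fz (fs q) ∘ₚ σ)
swap-gain {n} b j b↑ j↑ σ q σq≡0 = +-cancelʳ-< (C * u) _ _ (begin-strict
  (A * v + sum g) + C * u   ≡⟨ xy∙z≈xz∙y (A * v) (sum g) (C * u) ⟩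
  (A * v + C * u) + sum g   <⟨ +-monoˡ-< (sum g) (exchange b₀<b_q+1 u<v) ⟩
  (A * u + C * v) + sum g   ≡⟨ xy∙z≈x∙zy (A * u) (C * v) (sum g) ⟩
  A * u + (sum g + C * v)   ≡⟨ cong (A * u +_) tails ⟩
  A * u + (sum g′ + C * u)  ≡⟨ +-assoc (A * u) (sum g′) (C * u) ⟨
  (A * u + sum g′) + C * u  ≡⟨ cong (λ i → A * j i + sum g′ + C * u) (swap-to-zero σ q σq≡0) ⟨
  pairing b j σ′ + C * u    ∎)
  where
  open ≤-Reasoning
  σ′ = transpose fz (fs q) ∘ₚ σ
  A = b fz
  C = b (fs q)
  u = j fz
  v = j (σ ⟨$⟩ʳ fz)
  g g′ : Fin n → ℕ
  g  k = b (fs k) * j (σ ⟨$⟩ʳ fs k)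
  g′ k = b (fs k) * j (σ′ ⟨$⟩ʳ fs k)
  b₀<b_q+1 : A < C
  b₀<b_q+1 = b↑ {fz} {fs q} (s≤s z≤n)
  σ0≢0 : σ ⟨$⟩ʳ fz ≢ fz
  σ0≢0 σ0≡0 = Finₚ.0≢1+n (trans (sym (inverseˡ σ)) (trans (cong (σ ⟨$⟩ˡ_) (trans σ0≡0 (sym σq≡0))) (inverseˡ σ)))
  u<v : u < v
  u<v = j↑ (Finₚ.≤∧≢⇒< z≤n (σ0≢0 ∘ sym))
  off-q : ∀ k → k ≢ q → g k ≡ g′ k
  off-q k k≢q = cong (λ i → b (fs k) * j (σ ⟨$⟩ʳ i))
    (sym (transpose-other fz (fs q) (fs k) (λ ()) (k≢q ∘ Finₚ.suc-injective)))
  tails : sum g + C * v ≡ sum g′ + C * u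
  tails = subst₂ (λ x y → sum g + x ≡ sum g′ + y)
    (cong (λ i → C * j (σ ⟨$⟩ʳ i)) (transpose-right fz (fs q)))
    (cong (λ i → C * j i) σq≡0)
    (sum-update g g′ q off-q)

-- Induction on n, splitting on the
-- position σ⁻¹(0): if it is 0, restrict σ; otherwise one exchange step gains
-- strictly and produces a permutation fixing 0, which the restriction bounds.
rearrangement : ∀ {n} (b j : Fin n → ℕ) → StrictlyIncreasing b → StrictlyIncreasing j →
  (σ : Permutation′ n) → DominatedById b j σ
rearrangement {zero}  b j b↑ j↑ σ = inj₁ λ ()
rearrangement {suc n} b j b↑ j↑ σ = by-preimage-of-zero (σ ⟨$⟩ˡ fz) (inverseʳ σ)
  where
  restricted : ∀ ρ → DominatedById (tail b) (tail j) (remove fz ρ)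
  restricted ρ = rearrangement (tail b) (tail j) (increasing-tail b↑) (increasing-tail j↑) (remove fz ρ)
  fixing-zero : ∀ ρ → ρ ⟨$⟩ʳ fz ≡ fz → DominatedById b j ρ
  fixing-zero ρ ρ0≡0 = dominated-fixing-zero b j ρ ρ0≡0 (restricted ρ)
  by-preimage-of-zero : ∀ p → σ ⟨$⟩ʳ p ≡ fz → DominatedById b j σ
  by-preimage-of-zero fz     σ0≡0 = fixing-zero σ σ0≡0
  by-preimage-of-zero (fs q) σq≡0 = inj₂ (<-≤-trans (swap-gain b j b↑ j↑ σ q σq≡0)
    (dominated⇒≤ b j σ′ (fixing-zero σ′ (swap-to-zero σ q σq≡0))))
    where σ′ = transpose fz (fs q) ∘ₚ σ

strict-maximality : ∀ {n} (b j : Fin n → ℕ) → StrictlyIncreasing b → StrictlyIncreasing j →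
  (σ : Permutation′ n) → ¬ (σ ≈ id) → Σperm b j σ < Σperm b j id
strict-maximality b j b↑ j↑ σ σ≉id with rearrangement b j b↑ j↑ σ
... | inj₁ σ≈id = contradiction σ≈id σ≉id
... | inj₂ σ<id = subst₂ _<_ (sym (Σperm≡pairing b j σ)) (sym (Σperm≡pairing b j id)) σ<id

head-room : ∀ n {M} (f : Fin (suc n) → ℕ) → StrictlyIncreasing f → (∀ k → f k ≤ M) → f fz + n ≤ M
head-room zero    f f↑ f≤M = ≤-trans (≤-reflexive (+-identityʳ (f fz))) (f≤M fz)
head-room (suc n) {M} f f↑ f≤M = begin
  f fz + suc n    ≡⟨ +-suc (f fz) n ⟩
  suc (f fz) + n  ≤⟨ +-monoˡ-≤ n (f↑ {fz} {fs fz} (s≤s z≤n)) ⟩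
  f (fs fz) + n   ≤⟨ head-room n (tail f) (increasing-tail f↑) (λ k → f≤M (fs k)) ⟩
  M               ∎
  where open ≤-Reasoning

-- The first product b₀j₀ of the diagonal sum, when n larger pairs follow,
-- leaves room for n(B + R + 1): writing B = b₀ + n + u and R = j₀ + n + v,
-- 3BR − 3b₀j₀ − n(B+R+1) is a sum of nonnegative monomials (n² − n among them).
head-term-bound : ∀ b₀ j₀ n B R → b₀ + n ≤ B → j₀ + n ≤ R →
  3 * (b₀ * j₀) + n * (B + R + 1) ≤ 3 * (B * R)
head-term-bound b₀ j₀ n B R b₀+n≤B j₀+n≤R
  with m≤n⇒∃[o]m+o≡n b₀+n≤B | m≤n⇒∃[o]m+o≡n j₀+n≤R
head-term-bound b₀ j₀ zero B R _ _ | u , refl | v , refl =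
  ≤-trans (≤-reflexive (+-identityʳ _)) (*-monoʳ-≤ 3 (*-mono-≤ (le b₀ u) (le j₀ v)))
  where
  le : ∀ a u → a ≤ a + 0 + u
  le a u = ≤-trans (m≤m+n a 0) (m≤m+n (a + 0) u)
head-term-bound b₀ j₀ (suc m) B R _ _ | u , refl | v , refl =
  ≤-trans (m≤m+n _ slack) (≤-reflexive (expand b₀ j₀ m u v))
  where
  slack = 2 * (suc m * b₀) + 3 * (b₀ * v) + 2 * (suc m * j₀) + m * suc m
        + 2 * (suc m * v) + 3 * (u * j₀) + 2 * (u * suc m) + 3 * (u * v)
  expand : ∀ b₀ j₀ m u v →
    3 * (b₀ * j₀) + suc m * (b₀ + suc m + u + (j₀ + suc m + v) + 1)
      + (2 * (suc m * b₀) + 3 * (b₀ * v) + 2 * (suc m * j₀) + m * suc m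
        + 2 * (suc m * v) + 3 * (u * j₀) + 2 * (u * suc m) + 3 * (u * v))
    ≡ 3 * ((b₀ + suc m + u) * (j₀ + suc m + v))
  expand = solve-∀

choose-two-suc : ∀ n → suc n C 2 ≡ n + n C 2
choose-two-suc n = begin
  suc n C 2      ≡⟨ nCk+nC[k+1]≡[n+1]C[k+1] n 1 ⟨
  n C 1 + n C 2  ≡⟨ cong (_+ n C 2) (nC1≡n n) ⟩
  n + n C 2      ∎
  where open ≡-Reasoning

-- Induction on n, peeling off the smallest
-- pair with head-room and head-term-bound; C(n+1,2) = n + C(n,2) matches the
-- extra n(B+R+1) spent on the head.
diagonal-bound : ∀ n {B R} (b j : Fin n → ℕ) → StrictlyIncreasing b → StrictlyIncreasing j →
  (∀ k → b k ≤ B) → (∀ k → j k ≤ R) →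
  3 * Σperm b j id + (n C 2) * (B + R + 1) ≤ 3 * (n * B * R)
diagonal-bound zero    b j _ _ _ _ = z≤n
diagonal-bound (suc n) {B} {R} b j b↑ j↑ b≤B j≤R = begin
  3 * (b fz * j fz + T) + (suc n C 2) * D      ≡⟨ cong (λ c → 3 * (b fz * j fz + T) + c * D) (choose-two-suc n) ⟩
  3 * (b fz * j fz + T) + (n + n C 2) * D      ≡⟨ regroup (b fz * j fz) T (n C 2) n D ⟩
  (3 * (b fz * j fz) + n * D) + (3 * T + (n C 2) * D)
    ≤⟨ +-mono-≤ (head-term-bound (b fz) (j fz) n B R (head-room n b b↑ b≤B) (head-room n j j↑ j≤R))
                (diagonal-bound n (tail b) (tail j) (increasing-tail b↑) (increasing-tail j↑)
                                (λ k → b≤B (fs k)) (λ k → j≤R (fs k))) ⟩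
  3 * (B * R) + 3 * (n * B * R)                ≡⟨ regroup′ B R n ⟩
  3 * (suc n * B * R)                          ∎
  where
  open ≤-Reasoning
  D = B + R + 1
  T = Σperm (tail b) (tail j) id
  regroup : ∀ a T c n D → 3 * (a + T) + (n + c) * D ≡ (3 * a + n * D) + (3 * T + c * D)
  regroup = solve-∀
  regroup′ : ∀ B R n → 3 * (B * R) + 3 * (n * B * R) ≡ 3 * (suc n * B * R)
  regroup′ = solve-∀

bounds-sum : ∀ r d → 1 ≤ r → r ≤ d → d ∸ r + (r ∸ 1) + 1 ≡ d
bounds-sum (suc r) d (s≤s z≤n) r<d = begin
  d ∸ suc r + r + 1    ≡⟨ +-assoc (d ∸ suc r) r 1 ⟩
  d ∸ suc r + (r + 1)  ≡⟨ cong (d ∸ suc r +_) (+-comm r 1) ⟩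
  d ∸ suc r + suc r    ≡⟨ m∸n+n≡m r<d ⟩
  d                    ∎
  where open ≡-Reasoning

-- Write the larger of x, y as the smaller
-- plus e ≤ R; then the claim reduces to B·e ≤ … + B·R resp. 2b·e ≤ B·e + B·R.
spread-pointwise : ∀ {b B x y R} → b ≤ B → x ≤ R → y ≤ R →
  2 * (b * x) + B * y ≤ 2 * (b * y) + B * x + B * R
spread-pointwise {b} {B} {x} {y} {R} b≤B x≤R y≤R with ≤-total x y
... | inj₁ x≤y with m≤n⇒∃[o]m+o≡n x≤y
...   | e , refl = begin
  2 * (b * x) + B * (x + e)              ≡⟨ regroup b B x e ⟩
  (2 * (b * x) + B * x) + B * e          ≤⟨ +-monoʳ-≤ (2 * (b * x) + B * x) (*-monoʳ-≤ B (≤-trans (m≤n+m e x) y≤R)) ⟩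
  (2 * (b * x) + B * x) + B * R          ≤⟨ +-monoʳ-≤ (2 * (b * x) + B * x) (m≤n+m (B * R) (2 * (b * e))) ⟩
  (2 * (b * x) + B * x) + (2 * (b * e) + B * R) ≡⟨ regroup′ b B x e R ⟩
  2 * (b * (x + e)) + B * x + B * R      ∎
  where
  open ≤-Reasoning
  regroup : ∀ b B x e → 2 * (b * x) + B * (x + e) ≡ (2 * (b * x) + B * x) + B * e
  regroup = solve-∀
  regroup′ : ∀ b B x e R →
    (2 * (b * x) + B * x) + (2 * (b * e) + B * R) ≡ 2 * (b * (x + e)) + B * x + B * R
  regroup′ = solve-∀
spread-pointwise {b} {B} {x} {y} {R} b≤B x≤R y≤R | inj₂ y≤x with m≤n⇒∃[o]m+o≡n y≤x
...   | e , refl = begin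
  2 * (b * (y + e)) + B * y              ≡⟨ regroup b B y e ⟩
  (2 * (b * y) + B * y) + (b * e + b * e) ≤⟨ +-monoʳ-≤ (2 * (b * y) + B * y) (+-mono-≤ (*-monoˡ-≤ e b≤B) (*-mono-≤ b≤B e≤R)) ⟩
  (2 * (b * y) + B * y) + (B * e + B * R) ≡⟨ regroup′ b B y e R ⟩
  2 * (b * y) + B * (y + e) + B * R      ∎
  where
  open ≤-Reasoning
  e≤R : e ≤ R
  e≤R = ≤-trans (m≤n+m e y) x≤R
  regroup : ∀ b B y e → 2 * (b * (y + e)) + B * y ≡ (2 * (b * y) + B * y) + (b * e + b * e)
  regroup = solve-∀
  regroup′ : ∀ b B y e R →
    (2 * (b * y) + B * y) + (B * e + B * R) ≡ 2 * (b * y) + B * (y + e) + B * R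
  regroup′ = solve-∀

-- Sum the pointwise bound
-- with x = j∘σ, y = j∘τ; both sides then contain B·∑j, which cancels.
spread : ∀ {n} (b j : Fin n → ℕ) B R → (∀ k → b k ≤ B) → (∀ k → j k ≤ R) →
  (σ τ : Permutation′ n) → 2 * pairing b j σ ≤ 2 * pairing b j τ + n * B * R
spread {n} b j B R b≤B j≤R σ τ = +-cancelʳ-≤ (B * sum j) _ _ (begin
  2 * pairing b j σ + B * sum j                      ≡⟨ lhs ⟨
  sum (λ k → 2 * (b k * x k) + B * y k)              ≤⟨ sum-mono (λ k → spread-pointwise (b≤B k) (j≤R _) (j≤R _)) ⟩
  sum (λ k → 2 * (b k * y k) + B * x k + B * R)      ≡⟨ rhs ⟩
  2 * pairing b j τ + n * B * R + B * sum j          ∎)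
  where
  open ≤-Reasoning
  x y : Fin n → ℕ
  x k = j (σ ⟨$⟩ʳ k)
  y k = j (τ ⟨$⟩ʳ k)
  lhs : sum (λ k → 2 * (b k * x k) + B * y k) ≡ 2 * pairing b j σ + B * sum j
  lhs = trans (∑-distrib-+ (λ k → 2 * (b k * x k)) (λ k → B * y k))
              (cong₂ _+_ (sym (*-distribˡ-sum 2 (λ k → b k * x k))) (sum-scaled-permuted B j τ))
  rhs : sum (λ k → 2 * (b k * y k) + B * x k + B * R) ≡ 2 * pairing b j τ + n * B * R + B * sum j
  rhs = begin-equality
    sum (λ k → 2 * (b k * y k) + B * x k + B * R)
      ≡⟨ ∑-distrib-+ (λ k → 2 * (b k * y k) + B * x k) (λ _ → B * R) ⟩
    sum (λ k → 2 * (b k * y k) + B * x k) + sum {n} (λ _ → B * R)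
      ≡⟨ cong₂ _+_ (∑-distrib-+ (λ k → 2 * (b k * y k)) (λ k → B * x k)) (sum-const n (B * R)) ⟩
    sum (λ k → 2 * (b k * y k)) + sum (λ k → B * x k) + n * (B * R)
      ≡⟨ cong₂ (λ u v → u + v + n * (B * R)) (sym (*-distribˡ-sum 2 (λ k → b k * y k))) (sum-scaled-permuted B j σ) ⟩
    2 * pairing b j τ + B * sum j + n * (B * R)
      ≡⟨ regroup (2 * pairing b j τ) (B * sum j) n B R ⟩
    2 * pairing b j τ + n * B * R + B * sum j        ∎
    where
    regroup : ∀ a c n B R → a + c + n * (B * R) ≡ a + n * B * R + c
    regroup = solve-∀

spread-Σperm : ∀ {n} (b j : Fin n → ℕ) B R → (∀ k → b k ≤ B) → (∀ k → j k ≤ R) →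
  (σ τ : Permutation′ n) → 2 * Σperm b j σ ≤ 2 * Σperm b j τ + n * B * R
spread-Σperm b j B R b≤B j≤R σ τ =
  subst₂ (λ x y → 2 * x ≤ 2 * y + _) (sym (Σperm≡pairing b j σ)) (sym (Σperm≡pairing b j τ))
    (spread b j B R b≤B j≤R σ τ)

mainTheorem18 : (r d N : ℕ) → 1 ≤ r → r ≤ d → 1 ≤ N →
    (j b : Fin N → ℕ) →
    (∀ {k l : Fin N} → k <ᶠ l → j k < j l) →
    (∀ {k l : Fin N} → k <ᶠ l → b k < b l) →
    (∀ k → j k ≤ r ∸ 1) →
    (∀ k → b k ≤ d ∸ r) →
    ((σ : Permutation′ N) → ¬ (σ ≈ id) → Σperm b j σ < Σperm b j id)
    × (3 * Σperm b j id + (N C 2) * d ≤ 3 * (N * (d ∸ r) * (r ∸ 1)))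
    × ((σ τ : Permutation′ N) → 2 * Σperm b j σ ≤ 2 * Σperm b j τ + N * (d ∸ r) * (r ∸ 1))
mainTheorem18 r d N 1≤r r≤d _ j b j↑ b↑ j≤r-1 b≤d-r =
    strict-maximality b j b↑ j↑
  , subst (λ D → 3 * Σperm b j id + (N C 2) * D ≤ 3 * (N * (d ∸ r) * (r ∸ 1)))
          (bounds-sum r d 1≤r r≤d)
          (diagonal-bound N b j b↑ j↑ b≤d-r j≤r-1)
  , spread-Σperm b j (d ∸ r) (r ∸ 1) b≤d-r j≤r-1
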